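{- Let $\mathcal{B}$ be the class of all bipartite graphs and $\mathcal{H}$ the class of all shift graphs. Then $\sup_{H\in\mathcal{H}}c^{\mathcal{B}}_{\mathrm u}(H)=\infty$ and $\sup_{H\in\mathcal{H}}c^{\mathcal{B}}_{\mathrm l}(H)\le 2$. In particular, there is a monotone graph class $\mathcal{G}$ of bounded chromatic number and a class $\mathcal{H}$ that is not $(c^{\mathcal{G}}_{\mathrm u},c^{\mathcal{G}}_{\mathrm l})$-bounded.
   Context: All graphs are finite. For a directed graph $D$, the shift graph $\mathrm{shift}(D)$ is the undirected graph whose vertices are the edges of $D$, where two vertices $uv,xy\in E(D)$ are adjacent if and only if $v=x$. A class is monotone if closed under subgraphs. For graphs $G,H$, a homomorphism $\varphi\colon G\to H$ is a map $V(G)\to V(H)$ with $\varphi(u)\varphi(v)\in E(H)$ whenever $uv\in E(G)$. $\dot\cup$ denotes vertex-disjoint union. For a graph class $\mathcal{G}$ and a graph $H$, a $\mathcal{G}$-cover of $H$ is an edge-surjective homomorphism $\varphi\colon G_1\dot\cup\cdots\dot\cup G_t\to H$ with all $G_i\in\mathcal{G}$; it is called $t$-global, injective if each $\varphi|_{G_i}$ is injective, and $s$-local if $|\varphi^{ -1}(v)|\le s$ for all $v\in V(H)$. $\overline{\mathcal{G}}$ is the class of all vertex-disjoint unions of graphs in $\mathcal{G}$. $c^{\mathcal{G}}_{\mathrm u}(H)$ is the least $t$ such that $H$ has a $t$-global injective $\overline{\mathcal{G}}$-cover; $c^{\mathcal{G}}_{\mathrm l}(H)$ the least $s$ such that $H$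 has an $s$-local injective $\mathcal{G}$-cover. $\mathcal{H}$ is $(c^{\mathcal{G}}_{\mathrm u},c^{\mathcal{G}}_{\mathrm l})$-bounded if there is $f\colon\mathbb{N}\to\mathbb{R}_{\ge0}$ with $c^{\mathcal{G}}_{\mathrm l}(H)\le c^{\mathcal{G}}_{\mathrm u}(H)\le f(c^{\mathcal{G}}_{\mathrm l}(H))$ for all $H\in\mathcal{H}$. -}

module Defs where

import Level
open import Level using (0ℓ; Lift)
open import Data.Nat using (ℕ; _≤_; _<_)
open import Data.Fin using (Fin)
open import Data.Bool using (Bool; true; false; T)
open import Data.List using (List; length)
open import Data.List.Membership.Propositional using (_∈_)
open import Data.Product using (Σ; Σ-syntax; ∃; _×_; _,_; proj₁; proj₂)
open import Data.Sum using (_⊎_; inj₁; inj₂)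
open import Data.Empty using (⊥)
open import Relation.Nullary using (¬_)
open import Relation.Binary.PropositionalEquality using (_≡_; refl; subst; sym)
open import Function.Bundles using (_↔_; Inverse)
open import Function.Definitions using (Injective)

record Graph : Set₁ where
  field
    V      : Set
    E      : V → V → Set
    E-sym  : ∀ {u v} → E u v → E v u
    E-irr  : ∀ {u} → ¬ E u u
open Graph public

Finite : Graph → Set
Finite G = Σ[ n ∈ ℕ ] (V G ↔ Fin n)

Class : Set₂
Class = Graph → Set₁

IsHom : (G H : Graph) → (V G → V H) → Set
IsHom G H φ = ∀ {a b} → E G a b → E H (φ a) (φ b)

EdgeSurj : (G H : Graph) → (V G → V H) → Set
EdgeSurj G H φ = ∀ {x y} → E H x y →
  Σ[ a ∈ V G ] Σ[ b ∈ V G ] (E G a b × φ a ≡ x × φ b ≡ y)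

_≅_ : Graph → Graph → Set
G ≅ H = Σ[ f ∈ (V G ↔ V H) ]
  (∀ a b → (E G a b → E H (Inverse.to f a) (Inverse.to f b))
         × (E H (Inverse.to f a) (Inverse.to f b) → E G a b))

_⊆G_ : Graph → Graph → Set
G ⊆G H = Σ[ φ ∈ (V G → V H) ] (IsHom G H φ × Injective _≡_ _≡_ φ)

Monotone : Class → Set₁
Monotone 𝒢 = ∀ G H → 𝒢 H → Finite G → G ⊆G H → 𝒢 G

Colourable : ℕ → Graph → Set
Colourable k G = Σ[ c ∈ (V G → Fin k) ] (∀ {a b} → E G a b → ¬ c a ≡ c b)

BoundedChi : Class → Set₁
BoundedChi 𝒢 = Σ[ k ∈ ℕ ] (∀ G → 𝒢 G → Colourable k G)

Bipartite : Class
Bipartite G = Lift (Level.suc 0ℓ) (Finite G × Colourable 2 G)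

data UE {t : ℕ} (Gs : Fin t → Graph) : Σ (Fin t) (λ i → V (Gs i)) → Σ (Fin t) (λ i → V (Gs i)) → Set where
  inn : ∀ {i a b} → E (Gs i) a b → UE Gs (i , a) (i , b)

UE-sym : ∀ {t} {Gs : Fin t → Graph} {x y} → UE Gs x y → UE Gs y x
UE-sym {Gs = Gs} (inn {i} e) = inn (E-sym (Gs i) e)

UE-irr : ∀ {t} {Gs : Fin t → Graph} {x} → ¬ UE Gs x x
UE-irr {Gs = Gs} (inn {i} e) = E-irr (Gs i) e

⋃ : {t : ℕ} → (Fin t → Graph) → Graph
⋃ {t} Gs = record
  { V = Σ (Fin t) (λ i → V (Gs i))
  ; E = UE Gs
  ; E-sym = UE-sym
  ; E-irr = UE-irr
  }

Overline : Class → Class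
Overline 𝒢 G = Σ[ k ∈ ℕ ] Σ[ Gs ∈ (Fin k → Graph) ] ((∀ i → 𝒢 (Gs i)) × (G ≅ ⋃ Gs))

record Cover (𝒢 : Class) (H : Graph) : Set₁ where
  field
    t     : ℕ
    Gs    : Fin t → Graph
    inCls : ∀ i → 𝒢 (Gs i)
    φ     : V (⋃ Gs) → V H
    hom   : IsHom (⋃ Gs) H φ
    surj  : EdgeSurj (⋃ Gs) H φ
open Cover public

InjectiveCover : ∀ {𝒢 H} → Cover 𝒢 H → Set
InjectiveCover C = ∀ i → Injective _≡_ _≡_ (λ a → φ C (i , a))

AtMost : {A : Set} → ℕ → (A → Set) → Set
AtMost {A} s P = Σ[ xs ∈ List A ] (length xs ≤ s × (∀ a → P a → a ∈ xs))

LocalCover : ∀ {𝒢 H} → ℕ → Cover 𝒢 H → Set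
LocalCover {H = H} s C = ∀ (v : V H) → AtMost s (λ a → φ C a ≡ v)

HasGlobal : Class → Graph → ℕ → Set₁
HasGlobal 𝒢 H n = Σ[ C ∈ Cover (Overline 𝒢) H ] (Cover.t C ≡ n × InjectiveCover C)

HasLocal : Class → Graph → ℕ → Set₁
HasLocal 𝒢 H s = Σ[ C ∈ Cover 𝒢 H ] (InjectiveCover C × LocalCover s C)

IsCu : Class → Graph → ℕ → Set₁
IsCu 𝒢 H t = HasGlobal 𝒢 H t × (∀ t' → t' < t → ¬ HasGlobal 𝒢 H t')

IsCl : Class → Graph → ℕ → Set₁
IsCl 𝒢 H s = HasLocal 𝒢 H s × (∀ s' → s' < s → ¬ HasLocal 𝒢 H s')

CuClBounded : Class → Class → Set₁
CuClBounded 𝒢 ℋ = Σ[ f ∈ (ℕ → ℕ) ]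
  (∀ H → ℋ H → ∀ a b → IsCu 𝒢 H a → IsCl 𝒢 H b → b ≤ a × a ≤ f b)

record Digraph : Set₁ where
  field
    DV       : Set
    arc      : DV → DV → Bool
    loopless : ∀ v → arc v v ≡ false
    finite   : Σ[ n ∈ ℕ ] (DV ↔ Fin n)
open Digraph public

Arc : Digraph → Set
Arc D = Σ[ p ∈ DV D × DV D ] T (arc D (proj₁ p) (proj₂ p))

ShiftE : (D : Digraph) → Arc D → Arc D → Set
ShiftE D ((u , v) , _) ((x , y) , _) = (v ≡ x) ⊎ (y ≡ u)

private
  noLoop : (D : Digraph) → ∀ {u v} → T (arc D u v) → ¬ v ≡ u
  noLoop D {u} p refl = subst T (loopless D u) p

shift-irr : (D : Digraph) → ∀ {e} → ¬ ShiftE D e e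
shift-irr D {(u , v) , p} (inj₁ eq) = noLoop D p eq
shift-irr D {(u , v) , p} (inj₂ eq) = noLoop D p eq

shift-sym : (D : Digraph) → ∀ {e e'} → ShiftE D e e' → ShiftE D e' e
shift-sym D (inj₁ eq) = inj₂ eq
shift-sym D (inj₂ eq) = inj₁ eq

shift : Digraph → Graph
shift D = record
  { V = Arc D
  ; E = ShiftE D
  ; E-sym = λ {e} {e'} → shift-sym D {e} {e'}
  ; E-irr = λ {e} → shift-irr D {e}
  }

ShiftGraph : Class
ShiftGraph H = Σ[ D ∈ Digraph ] (H ≅ shift D)

-- A shift graph shift D is 2-locally covered by the stars of D: the arcs at a vertex v are those
-- entering and those leaving v, two arcs on the same side are never consecutive (D has no loops),
-- so every star is bipartite, and every arc lies in exactly the stars of its two endpoints.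
-- Globally, an injective cover by t unions of bipartite graphs colours H properly with 3 ^ t
-- colours: record, piece by piece, whether the piece meets a vertex and in which colour class.
-- The shift graph of the transitive tournament on n vertices needs log₂ n colours (Erdős–Hajnal),
-- so on these graphs c_u is unbounded while c_l stays at 2.
module Submission where

open import Defs
open import Level using (Level; lift; lower)
open import Data.Bool using (T)
open import Data.Bool.Properties using (T-irrelevant; T-≡)
open import Data.Empty using (⊥-elim)
open import Data.Fin using (Fin; zero; suc; funToFin; finToFun)
open import Data.Fin.Properties
  using (+↔⊎; *↔×; suc-injective; finToFun-funToFin; _≟_; _<?_) renaming (<-irrefl to <ᶠ-irrefl)
open import Data.List using (List; []; _∷_; length; filter; allFin)
open import Data.List.Properties using (length-tabulate)
open import Data.List.Relation.Unary.All using (_∷_)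
open import Data.List.Relation.Unary.AllPairs using (AllPairs; _∷_)
import Data.List.Relation.Unary.AllPairs.Properties as AllPairs
open import Data.List.Relation.Unary.Any as Any using (Any; any?; satisfied; here; there)
open import Data.List.Membership.Propositional using (_∈_; lose)
open import Data.List.Membership.Propositional.Properties using (∈-filter⁻; ∈-allFin)
open import Data.Nat using (ℕ; zero; suc; _+_; _*_; _^_; _≤_; _<_; z≤n; s≤s)
open import Data.Nat.Induction using (<-wellFounded)
open import Data.Nat.Properties
  using (≤-refl; ≤-trans; ≤-pred; m≤n⇒m≤1+n; <⇒≱; ^-monoʳ-≤; +-suc; +-identityʳ; +-mono-≤;
         module ≤-Reasoning)
open import Data.Product using (Σ; Σ-syntax; _×_; _,_; proj₁; proj₂)
open import Data.Product.Function.Dependent.Propositional using (Σ-↔)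
open import Data.Product.Function.NonDependent.Propositional using (_×-↔_)
open import Data.Sum using (_⊎_; inj₁; inj₂)
open import Data.Sum.Function.Propositional using (_⊎-↔_)
open import Function using (_∘_)
open import Function.Bundles using (_↔_; Inverse; Equivalence; mk↔ₛ′)
open import Function.Properties.Inverse using (↔-refl; ↔-sym; ↔-trans)
open import Induction.WellFounded using (Acc; acc)
import Relation.Nullary as Nullary
open import Relation.Nullary using (¬_; Dec; yes; no; does)
open import Relation.Nullary.Decidable using (T?; dec-true; dec-false; ¬¬-excluded-middle)
open import Relation.Nullary.Negation using (¬¬-map)
open import Relation.Unary using (Decidable; Irrelevant)
open import Relation.Unary.Properties using (∁?)
open import Relation.Binary.PropositionalEquality
  using (_≡_; refl; subst; subst₂; sym; trans; cong; module ≡-Reasoning)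

private
  variable
    ℓ : Level
    A B : Set

IsFinite : Set → Set
IsFinite A = Σ[ n ∈ ℕ ] (A ↔ Fin n)

↔-finite : A ↔ B → IsFinite B → IsFinite A
↔-finite e (n , f) = n , ↔-trans e f

Dec-finite : Dec A → Nullary.Irrelevant A → IsFinite A
Dec-finite (yes a) irr = 1 , mk↔ₛ′ (λ _ → zero) (λ _ → a) (λ { zero → refl }) (irr a)
Dec-finite (no ¬a) irr = 0 , mk↔ₛ′ (⊥-elim ∘ ¬a) (λ ()) (λ ()) (⊥-elim ∘ ¬a)

⊎-finite : IsFinite A → IsFinite B → IsFinite (A ⊎ B)
⊎-finite (m , e) (n , f) = m + n , ↔-trans (e ⊎-↔ f) (↔-sym +↔⊎)

×-finite : IsFinite A → IsFinite B → IsFinite (A × B)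
×-finite (m , e) (n , f) = m * n , ↔-trans (e ×-↔ f) (↔-sym *↔×)

Σ-Fin-suc↔ : ∀ {n} {P : Fin (suc n) → Set} → Σ (Fin (suc n)) P ↔ (P zero ⊎ Σ (Fin n) (P ∘ suc))
Σ-Fin-suc↔ {P = P} = mk↔ₛ′ to from (λ { (inj₁ _) → refl ; (inj₂ _) → refl })
                                  (λ { (zero , _) → refl ; (suc _ , _) → refl })
  where
  to : Σ (Fin _) P → P zero ⊎ Σ (Fin _) (P ∘ suc)
  to (zero  , p) = inj₁ p
  to (suc i , p) = inj₂ (i , p)

  from : P zero ⊎ Σ (Fin _) (P ∘ suc) → Σ (Fin _) P
  from (inj₁ p)       = zero , p
  from (inj₂ (i , p)) = suc i , p

Σ-Fin-finite : ∀ {n} {P : Fin n → Set} → Decidable P → Irrelevant P → IsFinite (Σ (Fin n) P)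
Σ-Fin-finite {zero}  _  _   = 0 , mk↔ₛ′ (λ ()) (λ ()) (λ ()) (λ ())
Σ-Fin-finite {suc n} P? irr =
  ↔-finite Σ-Fin-suc↔ (⊎-finite (Dec-finite (P? zero) irr) (Σ-Fin-finite (P? ∘ suc) irr))

Σ-finite : {P : A → Set} → IsFinite A → Decidable P → Irrelevant P → IsFinite (Σ A P)
Σ-finite (n , e) P? irr =
  ↔-finite (↔-sym (Σ-↔ (↔-sym e) ↔-refl)) (Σ-Fin-finite (P? ∘ Inverse.from e) irr)

¬¬-∀-Fin : ∀ {n} {Q : Fin n → Set ℓ} → (∀ i → ¬ ¬ Q i) → ¬ ¬ (∀ i → Q i)
¬¬-∀-Fin {n = zero}  _ k = k λ ()
¬¬-∀-Fin {n = suc n} h k =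
  h zero λ q₀ → ¬¬-∀-Fin (h ∘ suc) λ qₛ → k λ { zero → q₀ ; (suc i) → qₛ i }

¬¬-∀-finite : {Q : A → Set ℓ} → IsFinite A → (∀ a → ¬ ¬ Q a) → ¬ ¬ (∀ a → Q a)
¬¬-∀-finite {Q = Q} (n , e) h =
  ¬¬-map (λ q a → subst Q (Inverse.strictlyInverseʳ e a) (q (Inverse.to e a)))
         (¬¬-∀-Fin (h ∘ Inverse.from e))

Least : (ℕ → Set ℓ) → Set ℓ
Least P = Σ[ m ∈ ℕ ] (P m × (∀ k → k < m → ¬ P k))

¬¬-least : {P : ℕ → Set ℓ} {n : ℕ} → P n → ¬ ¬ Least P
¬¬-least {P = P} {n} = go (<-wellFounded n)
  where
  go : ∀ {n} → Acc _<_ n → P n → ¬ ¬ Least P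
  go {n} (acc rs) pn ¬least = ¬¬-excluded-middle {A = Σ[ m ∈ ℕ ] (m < n × P m)} λ
    { (yes (m , m<n , pm)) → go (rs m<n) pm ¬least
    ; (no ∄)               → ¬least (n , pn , λ m m<n pm → ∄ (m , m<n , pm)) }

length-filter+∁ : {P : A → Set} (P? : Decidable P) (xs : List A) →
                  length (filter P? xs) + length (filter (∁? P?) xs) ≡ length xs
length-filter+∁ P? []       = refl
length-filter+∁ P? (x ∷ xs) with P? x
... | yes _ = cong suc (length-filter+∁ P? xs)
... | no _  = trans (+-suc _ _) (cong suc (length-filter+∁ P? xs))

≅-refl : ∀ {G} → G ≅ G
≅-refl = ↔-refl , λ _ _ → (λ e → e) , (λ e → e)

induced : (H : Graph) {A : Set} → (A → V H) → Graph
induced H {A} f = record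
  { V     = A
  ; E     = λ a b → E H (f a) (f b)
  ; E-sym = E-sym H
  ; E-irr = E-irr H
  }

Colourable-pullback : ∀ {k G H} (f : V G → V H) → IsHom G H f → Colourable k H → Colourable k G
Colourable-pullback f hom (c , proper) = c ∘ f , proper ∘ hom

Colourable-⋃ : ∀ {k n} {Gs : Fin n → Graph} → (∀ i → Colourable k (Gs i)) → Colourable k (⋃ Gs)
Colourable-⋃ χ = (λ (i , a) → proj₁ (χ i) a) , λ { (inn {i} e) → proj₂ (χ i) e }

Overline-colourable : ∀ {𝒢 k} → (∀ G → 𝒢 G → Colourable k G) → ∀ G → Overline 𝒢 G → Colourable k G
Overline-colourable χ G (_ , Gs , inG , e , preserves) =
  Colourable-pullback {G = G} {⋃ Gs} (Inverse.to e) (λ {a} {b} → proj₁ (preserves a b))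
                      (Colourable-⋃ (λ i → χ (Gs i) (inG i)))

Bipartite-colourable : ∀ G → Bipartite G → Colourable 2 G
Bipartite-colourable _ = proj₂ ∘ lower

Bipartite-monotone : Monotone Bipartite
Bipartite-monotone G H bip finG (f , hom , _) =
  lift (finG , Colourable-pullback {G = G} {H} f hom (Bipartite-colourable H bip))

≅-singleton-⋃ : ∀ G → G ≅ ⋃ {1} (λ _ → G)
≅-singleton-⋃ G =
  mk↔ₛ′ (zero ,_) proj₂ (λ { (zero , _) → refl }) (λ _ → refl) , λ _ _ → inn , λ { (inn e) → e }

module _ {𝒢 : Class} {H : Graph} (C : Cover 𝒢 H) where

  wrap-pieces : Cover (Overline 𝒢) H
  wrap-pieces = record
    { t     = t C
    ; Gs    = Gs C
    ; inCls = λ i → 1 , _ , (λ _ → inCls C i) , ≅-singleton-⋃ (Gs C i)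
    ; φ     = φ C
    ; hom   = hom C
    ; surj  = surj C
    }

  merge-pieces : Cover (Overline 𝒢) H
  merge-pieces = record
    { t     = 1
    ; Gs    = λ _ → ⋃ (Gs C)
    ; inCls = λ _ → t C , Gs C , inCls C , ≅-refl {⋃ (Gs C)}
    ; φ     = φ C ∘ proj₂
    ; hom   = λ { (inn e) → hom C e }
    ; surj  = λ e → let (a , b , ab , ends) = surj C e in (zero , a) , (zero , b) , inn ab , ends
    }

HasLocal⇒HasGlobal : ∀ {𝒢 H s} → HasLocal 𝒢 H s → Σ[ n ∈ ℕ ] HasGlobal 𝒢 H n
HasLocal⇒HasGlobal (C , inj , _) = t C , wrap-pieces C , refl , inj

AtMost-1-unique : {P : A → Set} → AtMost 1 P → ∀ {a b} → P a → P b → a ≡ b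
AtMost-1-unique ([]          , _     , listed) pa _  with () ← listed _ pa
AtMost-1-unique (_ ∷ []      , _     , listed) pa pb
  with here refl ← listed _ pa | here refl ← listed _ pb = refl
AtMost-1-unique (_ ∷ _ ∷ _ , s≤s () , _)      _  _

HasLocal-1⇒HasGlobal-1 : ∀ {𝒢 H} → HasLocal 𝒢 H 1 → HasGlobal 𝒢 H 1
HasLocal-1⇒HasGlobal-1 (C , _ , local) =
  merge-pieces C , refl , λ _ {a} {b} e → AtMost-1-unique (local _) e refl

HasLocal-mono : ∀ {𝒢 H s s′} → s ≤ s′ → HasLocal 𝒢 H s → HasLocal 𝒢 H s′
HasLocal-mono s≤s′ (C , inj , local) =
  C , inj , λ v → let (xs , len , listed) = local v in xs , ≤-trans len s≤s′ , listed

module _ {G H : Graph} (iso : G ≅ H) where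

  private
    to = Inverse.to (proj₁ iso)
    from = Inverse.from (proj₁ iso)
    to-from : ∀ y → to (from y) ≡ y
    to-from = Inverse.strictlyInverseˡ (proj₁ iso)
    from-to : ∀ x → from (to x) ≡ x
    from-to = Inverse.strictlyInverseʳ (proj₁ iso)

  ≅-reflects : ∀ {x y} → E H x y → E G (from x) (from y)
  ≅-reflects {x} {y} e =
    proj₂ (proj₂ iso (from x) (from y)) (subst₂ (E H) (sym (to-from x)) (sym (to-from y)) e)

  HasLocal-≅ : ∀ {𝒢 s} → HasLocal 𝒢 H s → HasLocal 𝒢 G s
  HasLocal-≅ {𝒢} {s} (C , inj , local) = C′ , injective , local′
    where
    C′ : Cover 𝒢 G
    C′ = record
      { t     = t C
      ; Gs    = Gs C
      ; inCls = inCls C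
      ; φ     = from ∘ φ C
      ; hom   = λ e → ≅-reflects (hom C e)
      ; surj  = λ {x} {y} e → let (a , b , ab , a↦x , b↦y) = surj C (proj₁ (proj₂ iso x y) e) in
                  a , b , ab , trans (cong from a↦x) (from-to x) , trans (cong from b↦y) (from-to y)
      }

    injective : InjectiveCover C′
    injective i e = inj i (trans (sym (to-from _)) (trans (cong to e) (to-from _)))

    local′ : LocalCover s C′
    local′ v = let (xs , len , listed) = local (to v) in
      xs , len , λ a e → listed a (trans (sym (to-from _)) (cong to e))

module _ {H : Graph} (C : Cover (Overline Bipartite) H) (inj : InjectiveCover C) where

  Covers : Fin (t C) → V H → Set
  Covers i x = Σ[ a ∈ V (Gs C i) ] φ C (i , a) ≡ x

  private
    χ : ∀ i → Colourable 2 (Gs C i)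
    χ i = Overline-colourable Bipartite-colourable (Gs C i) (inCls C i)

    mark : ∀ {i x} → Dec (Covers i x) → Fin 3
    mark {i} (yes (a , _)) = suc (proj₁ (χ i) a)
    mark     (no _)        = zero

    mark-covered : ∀ {i a} (d : Dec (Covers i (φ C (i , a)))) → mark d ≡ suc (proj₁ (χ i) a)
    mark-covered {i} (yes (_ , e)) = cong (suc ∘ proj₁ (χ i)) (inj i e)
    mark-covered     (no ∄)        = ⊥-elim (∄ (_ , refl))

  cover-colouring : (∀ i x → Dec (Covers i x)) → Colourable (3 ^ t C) H
  cover-colouring covers? = colour , proper
    where
    word : V H → Fin (t C) → Fin 3
    word x i = mark (covers? i x)

    colour : V H → Fin (3 ^ t C)
    colour x = funToFin (word x)

    proper : ∀ {x y} → E H x y → ¬ colour x ≡ colour y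
    proper e same with surj C e
    ... | (i , a) , (_ , b) , inn ab , refl , refl = proj₂ (χ i) ab (suc-injective (begin
      suc (proj₁ (χ i) a)                ≡⟨ sym (mark-covered (covers? i _)) ⟩
      word (φ C (i , a)) i               ≡⟨ sym (finToFun-funToFin (word _) i) ⟩
      finToFun (colour (φ C (i , a))) i  ≡⟨ cong (λ c → finToFun c i) same ⟩
      finToFun (colour (φ C (i , b))) i  ≡⟨ finToFun-funToFin (word _) i ⟩
      word (φ C (i , b)) i               ≡⟨ mark-covered (covers? i _) ⟩
      suc (proj₁ (χ i) b)                ∎))
      where open ≡-Reasoning

-- Whether a piece covers a vertex is not decidable constructively, but for the finitely many
-- pairs (piece, vertex) excluded middle holds under a double negation.
HasGlobal⇒¬¬Colourable : ∀ {H n} → Finite H → HasGlobal Bipartite H n → ¬ ¬ Colourable (3 ^ n) H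
HasGlobal⇒¬¬Colourable finH (C , refl , inj) =
  ¬¬-map (cover-colouring C inj)
         (¬¬-∀-finite (t C , ↔-refl) λ _ → ¬¬-∀-finite finH λ _ → ¬¬-excluded-middle)

Arrow : (D : Digraph) → DV D → DV D → Set
Arrow D u v = T (arc D u v)

Arrow-irreflexive : ∀ D {u v} → Arrow D u v → ¬ u ≡ v
Arrow-irreflexive D {u} p refl = subst T (loopless D u) p

shift-finite : ∀ D → Finite (shift D)
shift-finite D = Σ-finite (×-finite (finite D) (finite D)) (λ (u , v) → T? (arc D u v)) T-irrelevant

shift-ShiftGraph : ∀ D → ShiftGraph (shift D)
shift-ShiftGraph D = D , ≅-refl {shift D}

module _ (D : Digraph) {k : ℕ} (κ : Colourable k (shift D)) where

  private
    colour : ∀ {u v} → Arrow D u v → Fin k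
    colour {u} {v} p = proj₁ κ ((u , v) , p)

    EnteredWith : Fin k → List (DV D) → DV D → Set
    EnteredWith c W j = Any (λ i → Σ[ p ∈ Arrow D i j ] colour p ≡ c) W

    enteredWith? : ∀ c W → Decidable (EnteredWith c W)
    enteredWith? c W j = any? arrowWith? W
      where
      arrowWith? : ∀ i → Dec (Σ[ p ∈ Arrow D i j ] colour p ≡ c)
      arrowWith? i with T? (arc D i j)
      ... | no ¬p = no (¬p ∘ proj₁)
      ... | yes p with colour p ≟ c
      ...   | yes e = yes (p , e)
      ...   | no ¬e = no λ (q , e) → ¬e (subst (λ r → colour r ≡ c) (T-irrelevant q p) e)

    -- The vertices of W entered by a c-coloured arrow from W span no c-coloured arrow (it would
    -- continue a c-coloured one), and neither do the others (its head would be entered).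
    tournament-length : (cs : List (Fin k)) (W : List (DV D)) → AllPairs (Arrow D) W →
                        (∀ {i j} → i ∈ W → j ∈ W → (p : Arrow D i j) → colour p ∈ cs) →
                        length W ≤ 2 ^ length cs
    tournament-length []       []          _             _    = z≤n
    tournament-length []       (_ ∷ [])    _             _    = s≤s z≤n
    tournament-length []       (_ ∷ _ ∷ _) ((p ∷ _) ∷ _) cols
      with () ← cols (here refl) (there (here refl)) p
    tournament-length (c ∷ cs) W           chain         cols = begin
      length W                       ≡⟨ sym (length-filter+∁ (enteredWith? c W) W) ⟩
      length Wᶜ + length W⁻          ≤⟨ +-mono-≤ (tournament-length cs Wᶜ (AllPairs.filter⁺ _ chain) colsᶜ)
                                                 (tournament-length cs W⁻ (AllPairs.filter⁺ _ chain) cols⁻) ⟩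
      2 ^ length cs + 2 ^ length cs  ≡⟨ cong (2 ^ length cs +_) (sym (+-identityʳ _)) ⟩
      2 ^ length (c ∷ cs)            ∎
      where
      open ≤-Reasoning
      Wᶜ = filter (enteredWith? c W) W
      W⁻ = filter (∁? (enteredWith? c W)) W

      colsᶜ : ∀ {i j} → i ∈ Wᶜ → j ∈ Wᶜ → (p : Arrow D i j) → colour p ∈ cs
      colsᶜ i∈ j∈ p with i∈W , entered ← ∈-filter⁻ (enteredWith? c W) i∈
                       | j∈W , _       ← ∈-filter⁻ (enteredWith? c W) j∈ =
        Any.tail (λ e → let (_ , q , e′) = satisfied entered in proj₂ κ (inj₁ refl) (trans e′ (sym e)))
                 (cols i∈W j∈W p)

      cols⁻ : ∀ {i j} → i ∈ W⁻ → j ∈ W⁻ → (p : Arrow D i j) → colour p ∈ cs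
      cols⁻ i∈ j∈ p with i∈W , _         ← ∈-filter⁻ (∁? (enteredWith? c W)) i∈
                       | j∈W , ¬entered ← ∈-filter⁻ (∁? (enteredWith? c W)) j∈ =
        Any.tail (λ e → ¬entered (lose i∈W (p , e))) (cols i∈W j∈W p)

  shift-colourable⇒tournament-≤ : (W : List (DV D)) → AllPairs (Arrow D) W → length W ≤ 2 ^ k
  shift-colourable⇒tournament-≤ W chain = begin
    length W               ≤⟨ tournament-length (allFin k) W chain (λ _ _ _ → ∈-allFin _) ⟩
    2 ^ length (allFin k)  ≡⟨ cong (2 ^_) (length-tabulate {n = k} (λ i → i)) ⟩
    2 ^ k                  ∎
    where open ≤-Reasoning

transitive-tournament : ℕ → Digraph
transitive-tournament n = record
  { DV       = Fin n
  ; arc      = λ i j → does (i <? j)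
  ; loopless = λ i → dec-false (i <? i) (<ᶠ-irrefl refl)
  ; finite   = n , ↔-refl
  }

shift-tournament-colourable⇒≤ : ∀ {n k} → Colourable k (shift (transitive-tournament n)) → n ≤ 2 ^ k
shift-tournament-colourable⇒≤ {n} κ = subst (_≤ _) (length-tabulate {n = n} (λ i → i))
  (shift-colourable⇒tournament-≤ (transitive-tournament n) κ (allFin n)
    (AllPairs.tabulate⁺-< λ {i} {j} i<j → Equivalence.from T-≡ (dec-true (i <? j) i<j)))

shift-tournament-¬HasGlobal : ∀ N {n} → n ≤ N →
                              ¬ HasGlobal Bipartite (shift (transitive-tournament (suc (2 ^ 3 ^ N)))) n
shift-tournament-¬HasGlobal N n≤N global =
  HasGlobal⇒¬¬Colourable (shift-finite (transitive-tournament (suc (2 ^ 3 ^ N)))) global λ κ →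
    <⇒≱ (shift-tournament-colourable⇒≤ κ) (^-monoʳ-≤ 2 (^-monoʳ-≤ 3 n≤N))

module _ (D : Digraph) where

  Incident : DV D → Set
  Incident v = (Σ[ u ∈ DV D ] Arrow D u v) ⊎ (Σ[ w ∈ DV D ] Arrow D v w)

  incident-arc : ∀ {v} → Incident v → Arc D
  incident-arc {v} (inj₁ (u , p)) = (u , v) , p
  incident-arc {v} (inj₂ (w , p)) = (v , w) , p

  incident-arc-injective : ∀ {v} {a b : Incident v} → incident-arc a ≡ incident-arc b → a ≡ b
  incident-arc-injective {a = inj₁ _}       {inj₁ _}       refl = refl
  incident-arc-injective {a = inj₂ _}       {inj₂ _}       refl = refl
  incident-arc-injective {a = inj₁ (_ , p)} {inj₂ _}       e    =
    ⊥-elim (Arrow-irreflexive D p (cong (proj₁ ∘ proj₁) e))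
  incident-arc-injective {a = inj₂ _}       {inj₁ (_ , q)} e    =
    ⊥-elim (Arrow-irreflexive D q (sym (cong (proj₁ ∘ proj₁) e)))

  incident-endpoint : ∀ {v u w} {p : Arrow D u w} (a : Incident v) →
                      incident-arc a ≡ ((u , w) , p) → v ≡ w ⊎ v ≡ u
  incident-endpoint (inj₁ _) refl = inj₁ refl
  incident-endpoint (inj₂ _) refl = inj₂ refl

  entering : ∀ {v u w} (p : Arrow D u w) → v ≡ w → Σ[ a ∈ Incident v ] incident-arc a ≡ ((u , w) , p)
  entering p refl = inj₁ (_ , p) , refl

  leaving : ∀ {v u w} (p : Arrow D u w) → v ≡ u → Σ[ a ∈ Incident v ] incident-arc a ≡ ((u , w) , p)
  leaving p refl = inj₂ (_ , p) , refl

  star : DV D → Graph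
  star v = induced (shift D) (incident-arc {v})

  star-bipartite : ∀ v → Bipartite (star v)
  star-bipartite v = lift (finite-incident , side , proper)
    where
    finite-incident : IsFinite (Incident v)
    finite-incident = ⊎-finite (Σ-finite (finite D) (λ u → T? (arc D u v)) T-irrelevant)
                               (Σ-finite (finite D) (λ w → T? (arc D v w)) T-irrelevant)

    side : Incident v → Fin 2
    side (inj₁ _) = zero
    side (inj₂ _) = suc zero

    proper : ∀ {a b} → E (star v) a b → ¬ side a ≡ side b
    proper {inj₁ _}       {inj₁ (_ , q)} (inj₁ e) _ = Arrow-irreflexive D q (sym e)
    proper {inj₁ (_ , p)} {inj₁ _}       (inj₂ e) _ = Arrow-irreflexive D p (sym e)
    proper {inj₂ (_ , p)} {inj₂ _}       (inj₁ e) _ = Arrow-irreflexive D p (sym e)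
    proper {inj₂ _}       {inj₂ (_ , q)} (inj₂ e) _ = Arrow-irreflexive D q (sym e)
    proper {inj₁ _}       {inj₂ _}       _        ()
    proper {inj₂ _}       {inj₁ _}       _        ()

  private
    to = Inverse.to (proj₂ (finite D))
    from = Inverse.from (proj₂ (finite D))
    from-to : ∀ v → from (to v) ≡ v
    from-to = Inverse.strictlyInverseʳ (proj₂ (finite D))
    to-from : ∀ i → to (from i) ≡ i
    to-from = Inverse.strictlyInverseˡ (proj₂ (finite D))

  star-cover : Cover Bipartite (shift D)
  star-cover = record
    { t     = proj₁ (finite D)
    ; Gs    = star ∘ from
    ; inCls = star-bipartite ∘ from
    ; φ     = incident-arc ∘ proj₂
    ; hom   = λ { (inn e) → e }
    ; surj  = surjective
    }
    where
    edge-in-star : ∀ i {x y} → Σ[ a ∈ Incident (from i) ] incident-arc a ≡ x →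
                   Σ[ b ∈ Incident (from i) ] incident-arc b ≡ y → ShiftE D x y →
                   Σ[ a ∈ V (⋃ (star ∘ from)) ] Σ[ b ∈ V (⋃ (star ∘ from)) ]
                     (UE (star ∘ from) a b × incident-arc (proj₂ a) ≡ x × incident-arc (proj₂ b) ≡ y)
    edge-in-star i (a , refl) (b , refl) s = (i , a) , (i , b) , inn s , refl , refl

    surjective : EdgeSurj (⋃ (star ∘ from)) (shift D) (incident-arc ∘ proj₂)
    surjective {(_ , v) , p} {_ , q} (inj₁ refl) =
      edge-in-star (to v) (entering p (from-to v)) (leaving q (from-to v)) (inj₁ refl)
    surjective {(u , _) , p} {_ , q} (inj₂ refl) =
      edge-in-star (to u) (leaving p (from-to u)) (entering q (from-to u)) (inj₂ refl)

  star-cover-injective : InjectiveCover star-cover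
  star-cover-injective _ = incident-arc-injective

  star-cover-local : LocalCover 2 star-cover
  star-cover-local ((u , w) , p) = candidates , s≤s (s≤s z≤n) , listed
    where
    at-w = entering p (from-to w)
    at-u = leaving p (from-to u)
    candidates = (to w , proj₁ at-w) ∷ (to u , proj₁ at-u) ∷ []

    same-piece : ∀ {i v} {a : Incident (from i)} {b : Incident (from (to v))} → from i ≡ v →
                 incident-arc a ≡ incident-arc b → _≡_ {A = V (⋃ (star ∘ from))} (i , a) (to v , b)
    same-piece {i} i↦v e with refl ← trans (sym (to-from i)) (cong to i↦v) = cong (_ ,_) (incident-arc-injective e)

    listed : ∀ x → incident-arc (proj₂ x) ≡ ((u , w) , p) → x ∈ candidates
    listed (i , a) e with incident-endpoint a e
    ... | inj₁ i↦w = here (same-piece i↦w (trans e (sym (proj₂ at-w))))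
    ... | inj₂ i↦u = there (here (same-piece i↦u (trans e (sym (proj₂ at-u)))))

shift-HasLocal-2 : ∀ H → ShiftGraph H → HasLocal Bipartite H 2
shift-HasLocal-2 H (D , H≅shift) =
  HasLocal-≅ H≅shift (star-cover D , star-cover-injective D , star-cover-local D)

shift-¬CuClBounded : ¬ CuClBounded Bipartite ShiftGraph
shift-¬CuClBounded (f , bounded) = ¬¬-least (proj₂ (HasLocal⇒HasGlobal local)) λ (a , cu) →
  shift-tournament-¬HasGlobal N (m≤n⇒m≤1+n (proj₂ (bounded H (shift-ShiftGraph D) a 2 cu cl))) (proj₁ cu)
  where
  N = suc (f 2)
  D = transitive-tournament (suc (2 ^ 3 ^ N))
  H = shift D
  local = shift-HasLocal-2 H (shift-ShiftGraph D)
  cl : IsCl Bipartite H 2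
  cl = local , λ s s<2 →
    shift-tournament-¬HasGlobal N (s≤s z≤n) ∘ HasLocal-1⇒HasGlobal-1 ∘ HasLocal-mono (≤-pred s<2)

proposition21 : (∀ (N : ℕ) → Σ[ H ∈ Graph ] (ShiftGraph H × (∀ t → t ≤ N → ¬ HasGlobal Bipartite H t)))
    × (∀ (H : Graph) → ShiftGraph H → Σ[ s ∈ ℕ ] (s ≤ 2 × HasLocal Bipartite H s))
    × (Σ[ 𝒢 ∈ Class ] Σ[ ℋ ∈ Class ] (Monotone 𝒢 × BoundedChi 𝒢 × ¬ CuClBounded 𝒢 ℋ))
proposition21 =
    (λ N → let D = transitive-tournament (suc (2 ^ 3 ^ N)) in
             shift D , shift-ShiftGraph D , λ _ → shift-tournament-¬HasGlobal N)
  , (λ H sh → 2 , ≤-refl , shift-HasLocal-2 H sh)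
  , (Bipartite , ShiftGraph , Bipartite-monotone , (2 , Bipartite-colourable) , shift-¬CuClBounded)
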